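{- There exist infinitely many positive integers $n$ such that $n^2+1$ is square-free and $\varepsilon:=n+\sqrt{n^2+1}$ is the fundamental unit of the real quadratic field $\mathbb{Q}(\sqrt{n^2+1})$. -}

module Defs where

open import Data.Nat as ℕ using (ℕ; suc)
open import Data.Nat.Divisibility using (_∣_)
open import Data.Integer as ℤ using (ℤ)
open import Data.Rational as ℚ using (ℚ; 0ℚ; 1ℚ)
open import Data.Product using (_×_; _,_; ∃; ∃-syntax; Σ-syntax)
open import Data.Sum using (_⊎_)
open import Relation.Binary.PropositionalEquality using (_≡_)

SquareFree : ℕ → Set
SquareFree m = ∀ (k : ℕ) → k ℕ.* k ∣ m → k ≡ 1

-- Elements of the quadratic field ℚ(√d):  the pair (a , b) stands for a + b√d.
-- (d is a positive non-square integer in the intended use; the field depends on d.)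
QF : Set
QF = ℚ × ℚ

module Field (d : ℕ) where

  dℚ : ℚ
  dℚ = ℤ.+ d ℚ./ 1

  _*Q_ : QF → QF → QF
  (a , b) *Q (c , e) = (a ℚ.* c ℚ.+ dℚ ℚ.* (b ℚ.* e)) , (a ℚ.* e ℚ.+ b ℚ.* c)

  -Q_ : QF → QF
  -Q (a , b) = (ℚ.- a) , (ℚ.- b)

  oneQ : QF
  oneQ = 1ℚ , 0ℚ

  _^Q_ : QF → ℕ → QF
  x ^Q 0 = oneQ
  x ^Q suc k = x *Q (x ^Q k)

  tr : QF → ℚ
  tr (a , b) = a ℚ.+ a

  nm : QF → ℚ
  nm (a , b) = a ℚ.* a ℚ.- dℚ ℚ.* (b ℚ.* b)

  IsIntegerℚ : ℚ → Set
  IsIntegerℚ q = ∃[ z ] q ≡ z ℚ./ 1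

  -- x is an algebraic integer: x is a root of the monic polynomial
  -- X² - tr(x) X + nm(x), which is its minimal/characteristic polynomial;
  -- x is integral iff these coefficients are integers.
  IsAlgInt : QF → Set
  IsAlgInt x = IsIntegerℚ (tr x) × IsIntegerℚ (nm x)

  IsUnit : QF → Set
  IsUnit x = IsAlgInt x × (Σ[ y ∈ QF ] (IsAlgInt y × (x *Q y ≡ oneQ)))

  -- positivity of the real number a + b√d (for d > 0), written out with rationals
  IsPos : QF → Set
  IsPos (a , b) =
      (0ℚ ℚ.≤ a × 0ℚ ℚ.≤ b × (0ℚ ℚ.< a ⊎ 0ℚ ℚ.< b))
    ⊎ (0ℚ ℚ.< a × b ℚ.< 0ℚ × dℚ ℚ.* (b ℚ.* b) ℚ.< a ℚ.* a)
    ⊎ (a ℚ.< 0ℚ × 0ℚ ℚ.< b × a ℚ.* a ℚ.< dℚ ℚ.* (b ℚ.* b))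

  GtOne : QF → Set
  GtOne (a , b) = IsPos ((a ℚ.- 1ℚ) , b)

  IsFundamentalUnit : QF → Set
  IsFundamentalUnit ε =
    IsUnit ε × GtOne ε ×
    (∀ u → IsUnit u → ∃[ k ]
        (  u ≡ ε ^Q k
         ⊎ u ≡ -Q (ε ^Q k)
         ⊎ u *Q (ε ^Q k) ≡ oneQ
         ⊎ u *Q (ε ^Q k) ≡ -Q oneQ))

-- Let d = n² + 1 and ε = n + √d, a unit of norm −1.  A unit u = p + q√d has integral trace 2p and
-- norm ±1, so d (2q)² = (2p)² ∓ 4 is an integer; d being square-free, 2q is an integer as well and
-- (2p, 2q) solves x² − d y² = ±4.  Dividing a solution with y ≥ 2 by ε yields a smaller solution
-- (with the other sign), while for n ≥ 3 there is none with y = 1; hence the solutions are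
-- (±2a, ±2b) with a + b√d = ε^k, and u = ±ε^(±k).
--
-- Square-free values n² + 1 are found by counting.  If every n in (m, M] had p² ∣ n² + 1 for some
-- prime p, then p ≥ 5 and n is determined by p and ⌊2n/p²⌋, because two square roots of −1
-- modulo p² differ or sum to a multiple of p².  For p ≤ K these data, and for p > K (when
-- p² > 2M leaves a single n) the number ⌊p/3⌋, encode n injectively by at most M/2 + K + M/3 + 1
-- codes, fewer than M − m when K = 2j and M = 2j² for j large.

module Submission where

module Arithmetic where

  open import Data.Nat
  open import Data.Nat.Properties
  open import Data.Nat.Divisibility using (∣-trans)
  open import Data.Nat.Coprimality using (Coprime; coprime-divisor)
  import Data.Nat.Coprimality as Coprime
  open import Data.Empty using (⊥)
  open import Data.Product using (_,_)
  open import Relation.Binary.PropositionalEquality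

  m*m≤n*n⇒m≤n : ∀ {m n} → m * m ≤ n * n → m ≤ n
  m*m≤n*n⇒m≤n m²≤n² = ≮⇒≥ λ n<m → <⇒≱ (*-mono-< n<m n<m) m²≤n²

  m*m<n*n⇒m<n : ∀ {m n} → m * m < n * n → m < n
  m*m<n*n⇒m<n m²<n² = ≰⇒> λ n≤m → <⇒≱ m²<n² (*-mono-≤ n≤m n≤m)

  no-square-between : ∀ m x → m * m < x * x → x * x < suc m * suc m → ⊥
  no-square-between m x m²<x² x²<[1+m]² = <⇒≱ x²<[1+m]² (*-mono-≤ m<x m<x)
    where m<x = m*m<n*n⇒m<n {m} {x} m²<x²

  ≤-witness : ∀ {m n} c → n ≡ m + c → m ≤ n
  ≤-witness {m} c refl = m≤m+n m c

  <-witness : ∀ {m n} c → n ≡ m + suc c → m < n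
  <-witness {m} c refl = m<m+n m z<s

  coprime-*ˡ : ∀ {m n o} → Coprime m o → Coprime n o → Coprime (m * n) o
  coprime-*ˡ {m} {n} {o} m⊥o n⊥o {i} (i∣mn , i∣o) = n⊥o (coprime-divisor i⊥m i∣mn , i∣o)
    where
      i⊥m : Coprime i m
      i⊥m (j∣i , j∣m) = m⊥o (j∣m , ∣-trans j∣i i∣o)

  coprime-square : ∀ {m n} → Coprime m n → Coprime (m * m) (n * n)
  coprime-square m⊥n = Coprime.sym (coprime-*ˡ n⊥m² n⊥m²)
    where n⊥m² = Coprime.sym (coprime-*ˡ m⊥n m⊥n)

module PellDescent where

  open Arithmetic
  open import Data.Nat
  open import Data.Nat.Properties
  open import Data.Nat.Induction using (<-rec)
  open import Data.Nat.Tactic.RingSolver using (solve-∀)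
  open import Data.Product using (∃; _×_; _,_)
  open import Data.Sum using (_⊎_; inj₁; inj₂)
  open import Data.Empty using (⊥-elim)
  open import Relation.Nullary using (¬_)
  open import Relation.Binary.PropositionalEquality
  open ≡-Reasoning

  square-*ˡ : ∀ m x → (m * x) * (m * x) ≡ m * (m * (x * x))
  square-*ˡ = solve-∀

  -- N(x′ + y′√d) · N(n + √d) = N(X + Y√d) for X + Y√d = (x′ + y′√d)(n + √d), where N(n + √d) = −1,
  -- with both sides moved so that no subtraction occurs
  norm-multiplicative : ∀ n x′ y′ →
    (n * x′ + (n * n + 1) * y′) * (n * x′ + (n * n + 1) * y′) + x′ * x′
    ≡ (n * n + 1) * ((n * y′ + x′) * (n * y′ + x′)) + (n * n + 1) * (y′ * y′)
  norm-multiplicative = solve-∀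

  module Pell (n : ℕ) where

    d : ℕ
    d = n * n + 1

    -- (n + √d) ^ k = a k + b k √d
    a b : ℕ → ℕ
    a zero    = 1
    a (suc k) = n * a k + d * b k
    b zero    = 0
    b (suc k) = a k + n * b k

    Pell±4 : ℕ → ℕ → Set
    Pell±4 x y = x * x + 4 ≡ d * (y * y) ⊎ x * x ≡ d * (y * y) + 4

    Pell±4[y≡0]⇒x≡2 : ∀ {x} → Pell±4 x 0 → x ≡ 2
    Pell±4[y≡0]⇒x≡2 {x} (inj₁ x²+4≡d*0) with () ← trans (+-comm 4 (x * x)) (trans x²+4≡d*0 (*-zeroʳ d))
    Pell±4[y≡0]⇒x≡2 {x} (inj₂ x²≡d*0+4) =
      ≤-antisym (m*m≤n*n⇒m≤n (≤-reflexive x²≡4)) (m*m≤n*n⇒m≤n (≤-reflexive (sym x²≡4)))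
      where x²≡4 = trans x²≡d*0+4 (cong (_+ 4) (*-zeroʳ d))

    ¬Pell±4[y≡1] : 3 ≤ n → ∀ {x} → ¬ Pell±4 x 1
    ¬Pell±4[y≡1] (s≤s (s≤s (s≤s {n = k} _))) {x} (inj₁ x²+4≡d) =
      no-square-between (2 + k) x (<-witness (2 * k + 1) x²≡) (<-witness 2 n²≡)
      where
        d≡ : ∀ k → ((3 + k) * (3 + k) + 1) * 1 ≡ ((2 + k) * (2 + k) + suc (2 * k + 1)) + 4
        d≡ = solve-∀
        x²≡ : x * x ≡ (2 + k) * (2 + k) + suc (2 * k + 1)
        x²≡ = +-cancelʳ-≡ 4 _ _ (trans x²+4≡d (d≡ k))
        n²≡ : (3 + k) * (3 + k) ≡ x * x + 3
        n²≡ = +-cancelʳ-≡ 1 _ _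
                (trans (sym (*-identityʳ d)) (trans (sym x²+4≡d) (sym (+-assoc (x * x) 3 1))))
    ¬Pell±4[y≡1] (s≤s (s≤s (s≤s {n = k} _))) {x} (inj₂ x²≡d+4) =
      no-square-between (3 + k) x (<-witness 4 x²≡) (<-witness (2 * k + 1) n+1²≡)
      where
        x²≡ : x * x ≡ (3 + k) * (3 + k) + 5
        x²≡ = trans x²≡d+4 (trans (cong (_+ 4) (*-identityʳ d)) (+-assoc ((3 + k) * (3 + k)) 1 4))
        [4+k]²≡ : ∀ k → (4 + k) * (4 + k) ≡ ((3 + k) * (3 + k) + 5) + suc (2 * k + 1)
        [4+k]²≡ = solve-∀
        n+1²≡ : (4 + k) * (4 + k) ≡ x * x + suc (2 * k + 1)
        n+1²≡ = trans ([4+k]²≡ k) (cong (_+ suc (2 * k + 1)) (sym x²≡))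

    Pell±4⇒bounds : ∀ {x y} → 2 ≤ y → Pell±4 x y → n * y ≤ x × n * x ≤ d * y
    Pell±4⇒bounds {x} {y@(suc (suc z))} (s≤s (s≤s _)) (inj₁ x²+4≡dy²) =
      m*m≤n*n⇒m≤n (≤-witness (4 * z + z * z) (+-cancelʳ-≡ 4 _ _ (trans x²+4≡dy² (dy²≡ n z)))) ,
      m*m≤n*n⇒m≤n (≤-witness (x * x + 4 * d) (begin
        (d * y) * (d * y)  ≡⟨ square-*ˡ d y ⟩
        d * (d * (y * y))  ≡⟨ cong (d *_) x²+4≡dy² ⟨
        d * (x * x + 4)    ≡⟨ d[x²+4]≡ n x ⟩
        (n * x) * (n * x) + (x * x + 4 * d) ∎))
      where
        dy²≡ : ∀ n z → (n * n + 1) * ((2 + z) * (2 + z)) ≡ ((n * (2 + z)) * (n * (2 + z)) + (4 * z + z * z)) + 4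
        dy²≡ = solve-∀
        d[x²+4]≡ : ∀ n x → (n * n + 1) * (x * x + 4) ≡ (n * x) * (n * x) + (x * x + 4 * (n * n + 1))
        d[x²+4]≡ = solve-∀
    Pell±4⇒bounds {x} {y@(suc (suc z))} (s≤s (s≤s _)) (inj₂ x²≡dy²+4) =
      m*m≤n*n⇒m≤n (≤-witness (y * y + 4) (trans x²≡dy²+4 (dy²+4≡ n y))) ,
      m*m≤n*n⇒m≤n (≤-witness e (begin
        (d * y) * (d * y)                ≡⟨ [dy]²≡ n z ⟩
        n * (n * (d * (y * y) + 4)) + e  ≡⟨ cong (λ t → n * (n * t) + e) x²≡dy²+4 ⟨
        n * (n * (x * x)) + e            ≡⟨ cong (_+ e) (square-*ˡ n x) ⟨
        (n * x) * (n * x) + e            ∎))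
      where
        e = 4 + d * (4 * z + z * z)
        dy²+4≡ : ∀ n y → (n * n + 1) * (y * y) + 4 ≡ (n * y) * (n * y) + (y * y + 4)
        dy²+4≡ = solve-∀
        [dy]²≡ : ∀ n z → ((n * n + 1) * (2 + z)) * ((n * n + 1) * (2 + z))
                         ≡ n * (n * ((n * n + 1) * ((2 + z) * (2 + z)) + 4)) + (4 + (n * n + 1) * (4 * z + z * z))
        [dy]²≡ = solve-∀

    -- (x + y√d)(√d − n) = x′ + y′√d
    divide-by-ε : ∀ {x y} → n * y ≤ x → n * x ≤ d * y →
                  ∃ λ x′ → ∃ λ y′ → x ≡ n * x′ + d * y′ × y ≡ n * y′ + x′
    divide-by-ε {x} {y} ny≤x nx≤dy with m≤n⇒∃[o]m+o≡n ny≤x | m≤n⇒∃[o]m+o≡n nx≤dy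
    ... | y′ , ny+y′≡x | x′ , nx+x′≡dy = x′ , y′ , x≡ , y≡
      where
        y≡ : y ≡ n * y′ + x′
        y≡ = +-cancelˡ-≡ (n * (n * y)) _ _ (begin
          n * (n * y) + y           ≡⟨ dy≡ n y ⟨
          d * y                     ≡⟨ nx+x′≡dy ⟨
          n * x + x′                ≡⟨ cong (λ t → n * t + x′) ny+y′≡x ⟨
          n * (n * y + y′) + x′     ≡⟨ regroup n y y′ x′ ⟩
          n * (n * y) + (n * y′ + x′) ∎)
          where
            dy≡ : ∀ n y → (n * n + 1) * y ≡ n * (n * y) + y
            dy≡ = solve-∀
            regroup : ∀ n y y′ x′ → n * (n * y + y′) + x′ ≡ n * (n * y) + (n * y′ + x′)
            regroup = solve-∀
        x≡ : x ≡ n * x′ + d * y′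
        x≡ = begin
          x                       ≡⟨ ny+y′≡x ⟨
          n * y + y′              ≡⟨ cong (λ t → n * t + y′) y≡ ⟩
          n * (n * y′ + x′) + y′  ≡⟨ regroup n y′ x′ ⟩
          n * x′ + d * y′         ∎
          where
            regroup : ∀ n y′ x′ → n * (n * y′ + x′) + y′ ≡ n * x′ + (n * n + 1) * y′
            regroup = solve-∀

    Pell±4-flip : ∀ x′ y′ → Pell±4 (n * x′ + d * y′) (n * y′ + x′) → Pell±4 x′ y′
    Pell±4-flip x′ y′ (inj₁ X²+4≡dY²) = inj₂ (+-cancelˡ-≡ (d * (Y * Y)) _ _ (begin
        d * (Y * Y) + x′ * x′             ≡⟨ cong (_+ x′ * x′) X²+4≡dY² ⟨
        (X * X + 4) + x′ * x′             ≡⟨ reorder (X * X) 4 (x′ * x′) ⟩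
        (X * X + x′ * x′) + 4             ≡⟨ cong (_+ 4) (norm-multiplicative n x′ y′) ⟩
        (d * (Y * Y) + d * (y′ * y′)) + 4 ≡⟨ +-assoc (d * (Y * Y)) _ 4 ⟩
        d * (Y * Y) + (d * (y′ * y′) + 4) ∎))
      where
        X = n * x′ + d * y′
        Y = n * y′ + x′
        reorder : ∀ p q r → (p + q) + r ≡ (p + r) + q
        reorder = solve-∀
    Pell±4-flip x′ y′ (inj₂ X²≡dY²+4) = inj₁ (+-cancelˡ-≡ (d * (Y * Y)) _ _ (begin
        d * (Y * Y) + (x′ * x′ + 4) ≡⟨ reorder (d * (Y * Y)) (x′ * x′) 4 ⟩
        (d * (Y * Y) + 4) + x′ * x′ ≡⟨ cong (_+ x′ * x′) X²≡dY²+4 ⟨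
        X * X + x′ * x′             ≡⟨ norm-multiplicative n x′ y′ ⟩
        d * (Y * Y) + d * (y′ * y′) ∎))
      where
        X = n * x′ + d * y′
        Y = n * y′ + x′
        reorder : ∀ p q r → p + (q + r) ≡ (p + r) + q
        reorder = solve-∀

    descent-decreases : 3 ≤ n → ∀ x′ y′ → 0 < n * y′ + x′ → y′ < n * y′ + x′
    descent-decreases _   x′ zero         0<x′ = 0<x′
    descent-decreases 3≤n x′ y′@(suc _) _ =
      <-≤-trans (m<m*n y′ n (≤-trans (s≤s (s≤s z≤n)) 3≤n))
                (subst (_≤ n * y′ + x′) (*-comm n y′) (m≤m+n (n * y′) x′))

    Pell±4⇒powers : 3 ≤ n → ∀ {x y} → Pell±4 x y → ∃ λ k → x ≡ 2 * a k × y ≡ 2 * b k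
    Pell±4⇒powers 3≤n {x} {y} = <-rec P descend y x
      where
        P : ℕ → Set
        P y = ∀ x → Pell±4 x y → ∃ λ k → x ≡ 2 * a k × y ≡ 2 * b k
        descend : ∀ y → (∀ {y′} → y′ < y → P y′) → P y
        descend 0               _   x e = 0 , Pell±4[y≡0]⇒x≡2 {x} e , refl
        descend 1               _   x e = ⊥-elim (¬Pell±4[y≡1] 3≤n {x} e)
        descend y@(suc (suc _)) rec x e with Pell±4⇒bounds {x} {y} (s≤s (s≤s z≤n)) e
        ... | ny≤x , nx≤dy with divide-by-ε {x} {y} ny≤x nx≤dy
        ... | x′ , y′ , x≡ , y≡ with rec y′<y x′ (Pell±4-flip x′ y′ (subst₂ Pell±4 x≡ y≡ e))
          where y′<y = subst (y′ <_) (sym y≡) (descent-decreases 3≤n x′ y′ (subst (0 <_) y≡ z<s))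
        ... | k , x′≡ , y′≡ =
          suc k ,
          trans x≡ (trans (cong₂ (λ p q → n * p + d * q) x′≡ y′≡) (double-a n d (a k) (b k))) ,
          trans y≡ (trans (cong₂ (λ p q → n * q + p) x′≡ y′≡) (double-b n (a k) (b k)))
          where
            double-a : ∀ n d p q → n * (2 * p) + d * (2 * q) ≡ 2 * (n * p + d * q)
            double-a = solve-∀
            double-b : ∀ n p q → n * (2 * q) + 2 * p ≡ 2 * (p + n * q)
            double-b = solve-∀

module IntegerEmbedding where

  open import Data.Nat as ℕ using (ℕ; suc)
  import Data.Nat.Properties as ℕ
  open import Data.Nat.Coprimality using (Coprime; 1-coprimeTo)
  import Data.Nat.Coprimality as Coprime
  open import Data.Integer as ℤ using (ℤ; +_; -[1+_])
  import Data.Integer.Properties as ℤ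
  open import Data.Rational as ℚ using (ℚ; mkℚ; _/_; 0ℚ; ½; ↥_; ↧_)
  import Data.Rational.Properties as ℚ
  open import Data.Rational.Solver using (module +-*-Solver)
  open +-*-Solver using (solve; _:=_; _:+_; _:*_; con)
  import Data.Rational.Unnormalised as ℚᵘ
  open import Data.Sum using (_⊎_; inj₁; inj₂)
  open import Relation.Binary.PropositionalEquality

  fromℤ : ℤ → ℚ
  fromℤ i = i / 1

  fromℕ : ℕ → ℚ
  fromℕ m = fromℤ (+ m)

  private
    coprime-1 : ∀ m → Coprime m 1
    coprime-1 m = Coprime.sym (1-coprimeTo m)

    fromℤ≡mkℚ : ∀ i → fromℤ i ≡ mkℚ i 0 (coprime-1 ℤ.∣ i ∣)
    fromℤ≡mkℚ (+ m)    = ℚ.normalize-coprime (coprime-1 m)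
    fromℤ≡mkℚ -[1+ m ] = cong ℚ.-_ (ℚ.normalize-coprime (coprime-1 (suc m)))

    /-cong-cross : ∀ i j a b → i ℤ.* + suc b ≡ j ℤ.* + suc a → i / suc a ≡ j / suc b
    /-cong-cross i j a b e = ℚ.fromℚᵘ-cong {ℚᵘ.mkℚᵘ i a} {ℚᵘ.mkℚᵘ j b} (ℚᵘ.*≡* e)

  fromℤ-injective : ∀ {i j} → fromℤ i ≡ fromℤ j → i ≡ j
  fromℤ-injective {i} {j} e rewrite fromℤ≡mkℚ i | fromℤ≡mkℚ j = cong ↥_ e

  fromℤ-homo-+ : ∀ i j → fromℤ (i ℤ.+ j) ≡ fromℤ i ℚ.+ fromℤ j
  fromℤ-homo-+ i j rewrite fromℤ≡mkℚ i | fromℤ≡mkℚ j =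
    /-cong-cross (i ℤ.+ j) (i ℤ.* + 1 ℤ.+ j ℤ.* + 1) 0 0
      (cong (ℤ._* + 1) (cong₂ ℤ._+_ (sym (ℤ.*-identityʳ i)) (sym (ℤ.*-identityʳ j))))

  fromℤ-homo-* : ∀ i j → fromℤ (i ℤ.* j) ≡ fromℤ i ℚ.* fromℤ j
  fromℤ-homo-* i j rewrite fromℤ≡mkℚ i | fromℤ≡mkℚ j = refl

  fromℤ-homo‿- : ∀ i → fromℤ (ℤ.- i) ≡ ℚ.- fromℤ i
  fromℤ-homo‿- i rewrite fromℤ≡mkℚ i | fromℤ≡mkℚ (ℤ.- i) with i
  ... | + 0      = refl
  ... | + suc m  = refl
  ... | -[1+ m ] = refl

  fromℤ-homo-∸ : ∀ i j → fromℤ (i ℤ.- j) ≡ fromℤ i ℚ.- fromℤ j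
  fromℤ-homo-∸ i j = trans (fromℤ-homo-+ i (ℤ.- j)) (cong (fromℤ i ℚ.+_) (fromℤ-homo‿- j))

  fromℕ-homo-+ : ∀ m k → fromℕ (m ℕ.+ k) ≡ fromℕ m ℚ.+ fromℕ k
  fromℕ-homo-+ m k = trans (cong fromℤ (ℤ.pos-+ m k)) (fromℤ-homo-+ (+ m) (+ k))

  fromℕ-homo-* : ∀ m k → fromℕ (m ℕ.* k) ≡ fromℕ m ℚ.* fromℕ k
  fromℕ-homo-* m k = trans (cong fromℤ (ℤ.pos-* m k)) (fromℤ-homo-* (+ m) (+ k))

  fromℕ-nonNegative : ∀ m → 0ℚ ℚ.≤ fromℕ m
  fromℕ-nonNegative m = ℚ.nonNegative⁻¹ (fromℕ m) {{ℚ.normalize-nonNeg m 1}}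

  ↧≡1⇒≡fromℤ↥ : ∀ r → ℚ.↧ₙ r ≡ 1 → r ≡ fromℤ (↥ r)
  ↧≡1⇒≡fromℤ↥ (mkℚ s 0 _) refl = sym (fromℤ≡mkℚ s)

  *-↧≡↥ : ∀ r → r ℚ.* fromℤ (↧ r) ≡ fromℤ (↥ r)
  *-↧≡↥ (mkℚ s t _) rewrite fromℤ≡mkℚ (+ suc t) =
    /-cong-cross (s ℤ.* + suc t) s (t ℕ.* 1) 0
      (trans (ℤ.*-identityʳ (s ℤ.* + suc t)) (cong (λ k → s ℤ.* + suc k) (sym (ℕ.*-identityʳ t))))

  _≡±_ : ℚ → ℕ → Set
  r ≡± m = r ≡ fromℕ m ⊎ r ≡ ℚ.- fromℕ m

  fromℤ≡± : ∀ i → fromℤ i ≡± ℤ.∣ i ∣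
  fromℤ≡± (+ m)    = inj₁ refl
  fromℤ≡± -[1+ m ] = inj₂ refl

  halve : ∀ {p q} → p ℚ.+ p ≡ q ℚ.+ q → p ≡ q
  halve {p} {q} e = trans (half p) (trans (cong (ℚ._* ½) e) (sym (half q)))
    where half = solve 1 (λ p → p := (p :+ p) :* con ½) refl

  fromℕ-double : ∀ m → fromℕ (2 ℕ.* m) ≡ fromℕ m ℚ.+ fromℕ m
  fromℕ-double m = trans (cong (λ k → fromℕ (m ℕ.+ k)) (ℕ.+-identityʳ m)) (fromℕ-homo-+ m m)

  r+r≡±2m⇒r≡±m : ∀ {r s} m → r ℚ.+ r ≡ s → s ≡± (2 ℕ.* m) → r ≡± m
  r+r≡±2m⇒r≡±m m r+r≡s (inj₁ s≡2m)  = inj₁ (halve (trans r+r≡s (trans s≡2m (fromℕ-double m))))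
  r+r≡±2m⇒r≡±m m r+r≡s (inj₂ s≡-2m) = inj₂ (halve (trans r+r≡s (trans s≡-2m
    (trans (cong ℚ.-_ (fromℕ-double m)) (ℚ.neg-distrib-+ (fromℕ m) (fromℕ m))))))

module FundamentalUnit where

  open import Defs
  open Arithmetic
  open PellDescent
  open IntegerEmbedding
  open import Data.Nat as ℕ using (ℕ; suc; zero; _≤_; s≤s; z≤n)
  import Data.Nat.Properties as ℕ
  open import Data.Nat.Divisibility using (_∣_; divides)
  open import Data.Nat.Coprimality using (coprime-divisor)
  import Data.Nat.Coprimality as Coprime
  open import Data.Integer as ℤ using (ℤ; +_; -[1+_])
  import Data.Integer.Properties as ℤ
  import Data.Integer.Tactic.RingSolver as ℤ-Solver
  open import Data.Rational as ℚ using (ℚ; mkℚ; 0ℚ; 1ℚ)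
  import Data.Rational.Properties as ℚ
  open import Data.Rational.Solver using (module +-*-Solver)
  open +-*-Solver
  open import Data.Product using (∃; _×_; _,_)
  open import Data.Sum using (_⊎_; inj₁; inj₂)
  open import Relation.Nullary.Decidable using (toWitness)
  open import Relation.Binary.PropositionalEquality
  open ≡-Reasoning

  _≡±1 : ℤ → Set
  i ≡±1 = i ≡ + 1 ⊎ i ≡ -[1+ 0 ]

  i*j≡1⇒i≡±1 : ∀ i j → i ℤ.* j ≡ + 1 → i ≡±1
  i*j≡1⇒i≡±1 i j ij≡1 with ℕ.m*n≡1⇒m≡1 ℤ.∣ i ∣ ℤ.∣ j ∣ (trans (sym (ℤ.abs-* i j)) (cong ℤ.∣_∣ ij≡1))
  i*j≡1⇒i≡±1 (+ .1)    j _ | refl = inj₁ refl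
  i*j≡1⇒i≡±1 -[1+ .0 ] j _ | refl = inj₂ refl

  i*i≡+∣i∣*∣i∣ : ∀ i → i ℤ.* i ≡ + (ℤ.∣ i ∣ ℕ.* ℤ.∣ i ∣)
  i*i≡+∣i∣*∣i∣ (+ m)    = ℤ.+◃n≡+n (m ℕ.* m)
  i*i≡+∣i∣*∣i∣ -[1+ m ] = refl

  i≡j+[i-j] : ∀ i j → i ≡ j ℤ.+ (i ℤ.- j)
  i≡j+[i-j] = ℤ-Solver.solve-∀

  i-[i-j]≡j : ∀ i j → i ℤ.- (i ℤ.- j) ≡ j
  i-[i-j]≡j = ℤ-Solver.solve-∀

  module _ (n : ℕ) where

    open Pell n
    open Field d

    ε ε⁻¹ : QF
    ε   = fromℕ n , 1ℚ
    ε⁻¹ = ℚ.- fromℕ n , 1ℚ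

    -- u = ±ε ^ k or u = ±ε ^ (− k)
    _≡±ε^±_ : QF → ℕ → Set
    u ≡±ε^± k = u ≡ ε ^Q k ⊎ u ≡ -Q (ε ^Q k) ⊎ u *Q (ε ^Q k) ≡ oneQ ⊎ u *Q (ε ^Q k) ≡ -Q oneQ

    dℚ≡n²+1 : dℚ ≡ fromℕ n ℚ.* fromℕ n ℚ.+ 1ℚ
    dℚ≡n²+1 = trans (fromℕ-homo-+ (n ℕ.* n) 1) (cong (ℚ._+ 1ℚ) (fromℕ-homo-* n n))

    ε^k≡ : ∀ k → ε ^Q k ≡ (fromℕ (a k) , fromℕ (b k))
    ε^k≡ zero    = refl
    ε^k≡ (suc k) = trans (cong (ε *Q_) (ε^k≡ k)) (cong₂ _,_ a-step b-step)
      where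
        A = fromℕ (a k)
        B = fromℕ (b k)
        a-step : fromℕ n ℚ.* A ℚ.+ dℚ ℚ.* (1ℚ ℚ.* B) ≡ fromℕ (a (suc k))
        a-step = begin
          fromℕ n ℚ.* A ℚ.+ dℚ ℚ.* (1ℚ ℚ.* B)      ≡⟨ cong (λ t → fromℕ n ℚ.* A ℚ.+ dℚ ℚ.* t) (ℚ.*-identityˡ B) ⟩
          fromℕ n ℚ.* A ℚ.+ dℚ ℚ.* B               ≡⟨ cong₂ ℚ._+_ (fromℕ-homo-* n (a k)) (fromℕ-homo-* d (b k)) ⟨
          fromℕ (n ℕ.* a k) ℚ.+ fromℕ (d ℕ.* b k)  ≡⟨ fromℕ-homo-+ (n ℕ.* a k) (d ℕ.* b k) ⟨
          fromℕ (a (suc k))                        ∎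
        b-step : fromℕ n ℚ.* B ℚ.+ 1ℚ ℚ.* A ≡ fromℕ (b (suc k))
        b-step = begin
          fromℕ n ℚ.* B ℚ.+ 1ℚ ℚ.* A  ≡⟨ cong (fromℕ n ℚ.* B ℚ.+_) (ℚ.*-identityˡ A) ⟩
          fromℕ n ℚ.* B ℚ.+ A         ≡⟨ ℚ.+-comm (fromℕ n ℚ.* B) A ⟩
          A ℚ.+ fromℕ n ℚ.* B         ≡⟨ cong (A ℚ.+_) (fromℕ-homo-* n (b k)) ⟨
          A ℚ.+ fromℕ (n ℕ.* b k)     ≡⟨ fromℕ-homo-+ (a k) (n ℕ.* b k) ⟨
          fromℕ (b (suc k))           ∎

    ε-isUnit : IsUnit ε
    ε-isUnit = ((+ n ℤ.+ + n , sym (fromℤ-homo-+ (+ n) (+ n))) , (-[1+ 0 ] , nm-ε)) ,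
               ε⁻¹ , ((ℤ.- + n ℤ.+ ℤ.- + n , tr-ε⁻¹) , (-[1+ 0 ] , nm-ε⁻¹)) , ε*ε⁻¹≡1
      where
        nm-ε : nm ε ≡ fromℤ -[1+ 0 ]
        nm-ε rewrite dℚ≡n²+1 = solve 1 (λ x →
          x :* x :- (x :* x :+ con 1ℚ) :* (con 1ℚ :* con 1ℚ) := :- con 1ℚ) refl (fromℕ n)
        nm-ε⁻¹ : nm ε⁻¹ ≡ fromℤ -[1+ 0 ]
        nm-ε⁻¹ rewrite dℚ≡n²+1 = solve 1 (λ x →
          :- x :* :- x :- (x :* x :+ con 1ℚ) :* (con 1ℚ :* con 1ℚ) := :- con 1ℚ) refl (fromℕ n)
        tr-ε⁻¹ : tr ε⁻¹ ≡ fromℤ (ℤ.- + n ℤ.+ ℤ.- + n)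
        tr-ε⁻¹ = sym (trans (fromℤ-homo-+ (ℤ.- + n) (ℤ.- + n))
                            (cong₂ ℚ._+_ (fromℤ-homo‿- (+ n)) (fromℤ-homo‿- (+ n))))
        ε*ε⁻¹≡1 : ε *Q ε⁻¹ ≡ oneQ
        ε*ε⁻¹≡1 rewrite dℚ≡n²+1 = cong₂ _,_
          (solve 1 (λ x → x :* :- x :+ (x :* x :+ con 1ℚ) :* (con 1ℚ :* con 1ℚ) := con 1ℚ) refl (fromℕ n))
          (solve 1 (λ x → x :* con 1ℚ :+ con 1ℚ :* :- x := con 0ℚ) refl (fromℕ n))

    ε>1 : 1 ≤ n → GtOne ε
    ε>1 (s≤s {n = m} z≤n) =
      inj₁ (0≤ε-1 , toWitness {a? = 0ℚ ℚ.≤? 1ℚ} _ , inj₂ (toWitness {a? = 0ℚ ℚ.<? 1ℚ} _))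
      where
        0≤ε-1 : 0ℚ ℚ.≤ fromℕ (suc m) ℚ.- 1ℚ
        0≤ε-1 = subst (0ℚ ℚ.≤_) (sym (begin
          fromℕ (suc m) ℚ.- 1ℚ     ≡⟨ cong (ℚ._- 1ℚ) (fromℕ-homo-+ 1 m) ⟩
          (1ℚ ℚ.+ fromℕ m) ℚ.- 1ℚ  ≡⟨ solve 1 (λ x → (con 1ℚ :+ x) :- con 1ℚ := x) refl (fromℕ m) ⟩
          fromℕ m                  ∎)) (fromℕ-nonNegative m)

    nm-*Q : ∀ u v → nm (u *Q v) ≡ nm u ℚ.* nm v
    nm-*Q (p , q) (r , s) = solve 5 (λ p q r s d →
      (p :* r :+ d :* (q :* s)) :* (p :* r :+ d :* (q :* s)) :- d :* ((p :* s :+ q :* r) :* (p :* s :+ q :* r))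
      := (p :* p :- d :* (q :* q)) :* (r :* r :- d :* (s :* s))) refl p q r s dℚ

    unit⇒norm±1 : ∀ u → IsUnit u → ∃ λ N → nm u ≡ fromℤ N × N ≡±1
    unit⇒norm±1 u ((_ , N , nm-u≡N) , v , (_ , N′ , nm-v≡N′) , uv≡1) =
      N , nm-u≡N , i*j≡1⇒i≡±1 N N′ (fromℤ-injective (begin
        fromℤ (N ℤ.* N′)      ≡⟨ fromℤ-homo-* N N′ ⟩
        fromℤ N ℚ.* fromℤ N′  ≡⟨ cong₂ ℚ._*_ nm-u≡N nm-v≡N′ ⟨
        nm u ℚ.* nm v         ≡⟨ nm-*Q u v ⟨
        nm (u *Q v)           ≡⟨ cong nm uv≡1 ⟩
        nm oneQ               ≡⟨ solve 1 (λ d → con 1ℚ :* con 1ℚ :- d :* (con 0ℚ :* con 0ℚ) := con 1ℚ) refl dℚ ⟩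
        fromℤ (+ 1)           ∎))

    squarefree⇒integral : SquareFree d → ∀ r M → dℚ ℚ.* (r ℚ.* r) ≡ fromℤ M → ∃ λ Y → r ≡ fromℤ Y
    squarefree⇒integral sf r@(mkℚ s t s⊥t+1) M dr²≡M = s , ↧≡1⇒≡fromℤ↥ r (sf (suc t) [t+1]²∣d)
      where
        D = + suc t
        ds²≡MD² : fromℤ (+ d ℤ.* (s ℤ.* s)) ≡ fromℤ (M ℤ.* (D ℤ.* D))
        ds²≡MD² = begin
          fromℤ (+ d ℤ.* (s ℤ.* s))
            ≡⟨ trans (fromℤ-homo-* (+ d) (s ℤ.* s)) (cong (dℚ ℚ.*_) (fromℤ-homo-* s s)) ⟩
          dℚ ℚ.* (fromℤ s ℚ.* fromℤ s)
            ≡⟨ cong (λ w → dℚ ℚ.* (w ℚ.* w)) (*-↧≡↥ r) ⟨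
          dℚ ℚ.* ((r ℚ.* fromℤ D) ℚ.* (r ℚ.* fromℤ D))
            ≡⟨ solve 3 (λ d r D → (d :* (r :* r)) :* (D :* D) := d :* ((r :* D) :* (r :* D))) refl dℚ r (fromℤ D) ⟨
          (dℚ ℚ.* (r ℚ.* r)) ℚ.* (fromℤ D ℚ.* fromℤ D)
            ≡⟨ cong (ℚ._* (fromℤ D ℚ.* fromℤ D)) dr²≡M ⟩
          fromℤ M ℚ.* (fromℤ D ℚ.* fromℤ D)
            ≡⟨ trans (fromℤ-homo-* M (D ℤ.* D)) (cong (fromℤ M ℚ.*_) (fromℤ-homo-* D D)) ⟨
          fromℤ (M ℤ.* (D ℤ.* D))
            ∎
        d∣s∣²≡∣M∣D² : d ℕ.* (ℤ.∣ s ∣ ℕ.* ℤ.∣ s ∣) ≡ ℤ.∣ M ∣ ℕ.* (suc t ℕ.* suc t)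
        d∣s∣²≡∣M∣D² = begin
          d ℕ.* (ℤ.∣ s ∣ ℕ.* ℤ.∣ s ∣)    ≡⟨ trans (ℤ.abs-* (+ d) (s ℤ.* s)) (cong (d ℕ.*_) (ℤ.abs-* s s)) ⟨
          ℤ.∣ + d ℤ.* (s ℤ.* s) ∣        ≡⟨ cong ℤ.∣_∣ (fromℤ-injective {+ d ℤ.* (s ℤ.* s)} {M ℤ.* (D ℤ.* D)} ds²≡MD²) ⟩
          ℤ.∣ M ℤ.* (D ℤ.* D) ∣          ≡⟨ trans (ℤ.abs-* M (D ℤ.* D)) (cong (ℤ.∣ M ∣ ℕ.*_) (ℤ.abs-* D D)) ⟩
          ℤ.∣ M ∣ ℕ.* (suc t ℕ.* suc t)  ∎
        [t+1]²∣d : suc t ℕ.* suc t ∣ d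
        [t+1]²∣d = coprime-divisor (coprime-square (Coprime.sym (Coprime.recompute s⊥t+1)))
                     (divides ℤ.∣ M ∣ (trans (ℕ.*-comm _ d) d∣s∣²≡∣M∣D²))

    d[2q]²≡X²-4N : ∀ p q X N → p ℚ.+ p ≡ fromℤ X → nm (p , q) ≡ fromℤ N →
                   dℚ ℚ.* ((q ℚ.+ q) ℚ.* (q ℚ.+ q)) ≡ fromℤ (X ℤ.* X ℤ.- + 4 ℤ.* N)
    d[2q]²≡X²-4N p q X N 2p≡X nm≡N = begin
      dℚ ℚ.* ((q ℚ.+ q) ℚ.* (q ℚ.+ q))
        ≡⟨ solve 3 (λ p q d → d :* ((q :+ q) :* (q :+ q))
                              := (p :+ p) :* (p :+ p) :- con (fromℕ 4) :* (p :* p :- d :* (q :* q))) refl p q dℚ ⟩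
      (p ℚ.+ p) ℚ.* (p ℚ.+ p) ℚ.- fromℕ 4 ℚ.* nm (p , q)
        ≡⟨ cong₂ (λ s t → s ℚ.* s ℚ.- fromℕ 4 ℚ.* t) 2p≡X nm≡N ⟩
      fromℤ X ℚ.* fromℤ X ℚ.- fromℕ 4 ℚ.* fromℤ N
        ≡⟨ cong₂ ℚ._-_ (fromℤ-homo-* X X) (fromℤ-homo-* (+ 4) N) ⟨
      fromℤ (X ℤ.* X) ℚ.- fromℤ (+ 4 ℤ.* N)
        ≡⟨ fromℤ-homo-∸ (X ℤ.* X) (+ 4 ℤ.* N) ⟨
      fromℤ (X ℤ.* X ℤ.- + 4 ℤ.* N)
        ∎

    X²-dY²≡4N : ∀ p q X Y N → p ℚ.+ p ≡ fromℤ X → q ℚ.+ q ≡ fromℤ Y → nm (p , q) ≡ fromℤ N →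
                X ℤ.* X ℤ.- + d ℤ.* (Y ℤ.* Y) ≡ + 4 ℤ.* N
    X²-dY²≡4N p q X Y N 2p≡X 2q≡Y nm≡N = fromℤ-injective (begin
      fromℤ (X ℤ.* X ℤ.- + d ℤ.* (Y ℤ.* Y))
        ≡⟨ fromℤ-homo-∸ (X ℤ.* X) (+ d ℤ.* (Y ℤ.* Y)) ⟩
      fromℤ (X ℤ.* X) ℚ.- fromℤ (+ d ℤ.* (Y ℤ.* Y))
        ≡⟨ cong₂ ℚ._-_ (fromℤ-homo-* X X) (trans (fromℤ-homo-* (+ d) (Y ℤ.* Y)) (cong (dℚ ℚ.*_) (fromℤ-homo-* Y Y))) ⟩
      fromℤ X ℚ.* fromℤ X ℚ.- dℚ ℚ.* (fromℤ Y ℚ.* fromℤ Y)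
        ≡⟨ cong₂ (λ s t → s ℚ.* s ℚ.- dℚ ℚ.* (t ℚ.* t)) 2p≡X 2q≡Y ⟨
      (p ℚ.+ p) ℚ.* (p ℚ.+ p) ℚ.- dℚ ℚ.* ((q ℚ.+ q) ℚ.* (q ℚ.+ q))
        ≡⟨ solve 3 (λ p q d → (p :+ p) :* (p :+ p) :- d :* ((q :+ q) :* (q :+ q))
                              := con (fromℕ 4) :* (p :* p :- d :* (q :* q))) refl p q dℚ ⟩
      fromℕ 4 ℚ.* nm (p , q)
        ≡⟨ cong (fromℕ 4 ℚ.*_) nm≡N ⟩
      fromℕ 4 ℚ.* fromℤ N
        ≡⟨ fromℤ-homo-* (+ 4) N ⟨
      fromℤ (+ 4 ℤ.* N)
        ∎)

    ∣X∣²-d∣Y∣²≡4N : ∀ X Y N → X ℤ.* X ℤ.- + d ℤ.* (Y ℤ.* Y) ≡ + 4 ℤ.* N →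
                    + (ℤ.∣ X ∣ ℕ.* ℤ.∣ X ∣) ℤ.- + (d ℕ.* (ℤ.∣ Y ∣ ℕ.* ℤ.∣ Y ∣)) ≡ + 4 ℤ.* N
    ∣X∣²-d∣Y∣²≡4N X Y N = subst (λ t → t ≡ + 4 ℤ.* N)
      (cong₂ ℤ._-_ (i*i≡+∣i∣*∣i∣ X) (trans (cong (+ d ℤ.*_) (i*i≡+∣i∣*∣i∣ Y)) (sym (ℤ.pos-* d _))))

    ℤ-Pell⇒Pell±4 : ∀ X Y N → X ℤ.* X ℤ.- + d ℤ.* (Y ℤ.* Y) ≡ + 4 ℤ.* N → N ≡±1 → Pell±4 ℤ.∣ X ∣ ℤ.∣ Y ∣
    ℤ-Pell⇒Pell±4 X Y N X²-dY²≡4N (inj₁ refl) = inj₂ (ℤ.+-injective (begin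
      + x²                         ≡⟨ i≡j+[i-j] (+ x²) (+ dy²) ⟩
      + dy² ℤ.+ (+ x² ℤ.- + dy²)   ≡⟨ cong (ℤ._+_ (+ dy²)) (∣X∣²-d∣Y∣²≡4N X Y N X²-dY²≡4N) ⟩
      + dy² ℤ.+ + 4                ≡⟨ ℤ.pos-+ dy² 4 ⟨
      + (dy² ℕ.+ 4)                ∎))
      where
        x² = ℤ.∣ X ∣ ℕ.* ℤ.∣ X ∣
        dy² = d ℕ.* (ℤ.∣ Y ∣ ℕ.* ℤ.∣ Y ∣)
    ℤ-Pell⇒Pell±4 X Y N X²-dY²≡4N (inj₂ refl) = inj₁ (ℤ.+-injective (begin
      + (x² ℕ.+ 4)                 ≡⟨ ℤ.pos-+ x² 4 ⟩
      + x² ℤ.- (+ 4 ℤ.* -[1+ 0 ])  ≡⟨ cong (ℤ._-_ (+ x²)) (∣X∣²-d∣Y∣²≡4N X Y N X²-dY²≡4N) ⟨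
      + x² ℤ.- (+ x² ℤ.- + dy²)    ≡⟨ i-[i-j]≡j (+ x²) (+ dy²) ⟩
      + dy²                        ∎))
      where
        x² = ℤ.∣ X ∣ ℕ.* ℤ.∣ X ∣
        dy² = d ℕ.* (ℤ.∣ Y ∣ ℕ.* ℤ.∣ Y ∣)

    private
      ≡±oneQ : QF → Set
      ≡±oneQ w = w ≡ oneQ ⊎ w ≡ -Q oneQ

      ±1⇒≡±oneQ : ∀ {r N} → r ≡ fromℤ N → N ≡±1 → ≡±oneQ (r , 0ℚ)
      ±1⇒≡±oneQ r≡N (inj₁ refl) = inj₁ (cong (_, 0ℚ) r≡N)
      ±1⇒≡±oneQ r≡N (inj₂ refl) = inj₂ (cong (_, 0ℚ) r≡N)

      ±1⇒-≡±oneQ : ∀ {r N} → r ≡ fromℤ N → N ≡±1 → ≡±oneQ (ℚ.- r , 0ℚ)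
      ±1⇒-≡±oneQ r≡N (inj₁ refl) = inj₂ (cong (λ t → ℚ.- t , 0ℚ) r≡N)
      ±1⇒-≡±oneQ r≡N (inj₂ refl) = inj₁ (cong (λ t → ℚ.- t , 0ℚ) r≡N)

    conjugate-product : ∀ A B → (A , ℚ.- B) *Q (A , B) ≡ (nm (A , ℚ.- B) , 0ℚ)
    conjugate-product A B = cong₂ _,_
      (solve 3 (λ A B d → A :* A :+ d :* (:- B :* B) := A :* A :- d :* (:- B :* :- B)) refl A B dℚ)
      (solve 2 (λ A B → A :* B :+ :- B :* A := con 0ℚ) refl A B)

    conjugate-product′ : ∀ A B → (ℚ.- A , B) *Q (A , B) ≡ (ℚ.- nm (ℚ.- A , B) , 0ℚ)
    conjugate-product′ A B = cong₂ _,_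
      (solve 3 (λ A B d → :- A :* A :+ d :* (B :* B) := :- (:- A :* :- A :- d :* (B :* B))) refl A B dℚ)
      (solve 2 (λ A B → :- A :* B :+ B :* A := con 0ℚ) refl A B)

    signs⇒≡±ε^± : ∀ {p q N} k → nm (p , q) ≡ fromℤ N → N ≡±1 → p ≡± a k → q ≡± b k → (p , q) ≡±ε^± k
    signs⇒≡±ε^± k _ _ (inj₁ refl) (inj₁ refl) = inj₁ (sym (ε^k≡ k))
    signs⇒≡±ε^± k _ _ (inj₂ refl) (inj₂ refl) = inj₂ (inj₁ (cong -Q_ (sym (ε^k≡ k))))
    signs⇒≡±ε^± k nm≡N N≡±1 (inj₁ refl) (inj₂ refl) = inj₂ (inj₂ (subst ≡±oneQ
      (sym (trans (cong ((A , ℚ.- B) *Q_) (ε^k≡ k)) (conjugate-product A B))) (±1⇒≡±oneQ nm≡N N≡±1)))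
      where
        A = fromℕ (a k)
        B = fromℕ (b k)
    signs⇒≡±ε^± k nm≡N N≡±1 (inj₂ refl) (inj₁ refl) = inj₂ (inj₂ (subst ≡±oneQ
      (sym (trans (cong ((ℚ.- A , B) *Q_) (ε^k≡ k)) (conjugate-product′ A B))) (±1⇒-≡±oneQ nm≡N N≡±1)))
      where
        A = fromℕ (a k)
        B = fromℕ (b k)

    unit⇒≡±ε^± : 3 ≤ n → SquareFree d → ∀ u → IsUnit u → ∃ (u ≡±ε^±_)
    unit⇒≡±ε^± 3≤n sf (p , q) U@(((X , 2p≡X) , _) , _) =
      let N , nm≡N , N≡±1 = unit⇒norm±1 (p , q) U
          Y , 2q≡Y = squarefree⇒integral sf (q ℚ.+ q) (X ℤ.* X ℤ.- + 4 ℤ.* N) (d[2q]²≡X²-4N p q X N 2p≡X nm≡N)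
          pell = ℤ-Pell⇒Pell±4 X Y N (X²-dY²≡4N p q X Y N 2p≡X 2q≡Y nm≡N) N≡±1
          k , ∣X∣≡2a , ∣Y∣≡2b = Pell±4⇒powers 3≤n {ℤ.∣ X ∣} {ℤ.∣ Y ∣} pell
      in k , signs⇒≡±ε^± {p} {q} {N} k nm≡N N≡±1
               (r+r≡±2m⇒r≡±m {p} {fromℤ X} (a k) 2p≡X (subst (fromℤ X ≡±_) ∣X∣≡2a (fromℤ≡± X)))
               (r+r≡±2m⇒r≡±m {q} {fromℤ Y} (b k) 2q≡Y (subst (fromℤ Y ≡±_) ∣Y∣≡2b (fromℤ≡± Y)))

    ε-fundamental : 3 ≤ n → SquareFree d → IsFundamentalUnit ε
    ε-fundamental 3≤n sf = ε-isUnit , ε>1 (ℕ.≤-trans (s≤s z≤n) 3≤n) , unit⇒≡±ε^± 3≤n sf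

module SquareFreeValues where

  open import Defs using (SquareFree)
  open Arithmetic
  open import Data.Nat
  open import Data.Nat.Properties
  open import Data.Nat.Induction using (<-rec)
  open import Data.Nat.Divisibility
  open import Data.Nat.DivMod
  open import Data.Nat.Primality
  open import Data.Nat.Coprimality using (Coprime; coprime-divisor)
  open import Data.Nat.Tactic.RingSolver using (solve-∀)
  open import Data.Fin using (Fin; toℕ; fromℕ<) renaming (_<_ to _<ᶠ_)
  import Data.Fin.Properties as Fin
  open import Data.Product using (∃; _×_; _,_; proj₁)
  open import Data.Sum using (_⊎_; inj₁; inj₂)
  open import Data.Empty using (⊥; ⊥-elim)
  open import Relation.Nullary using (¬_; Dec; yes; no; contradiction)
  open import Relation.Nullary.Decidable using (True; toWitness; ¬?; _×-dec_)
  open import Relation.Binary.PropositionalEquality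
  open import Relation.Binary.Definitions using (tri<; tri≈; tri>)

  prime∤⇒coprime : ∀ {p m} → Prime p → ¬ p ∣ m → Coprime p m
  prime∤⇒coprime pr p∤m (i∣p , i∣m) with prime⇒irreducible pr i∣p
  ... | inj₁ i≡1 = i≡1
  ... | inj₂ refl = contradiction i∣m p∤m

  prime≥2 : ∀ {p} → Prime p → 2 ≤ p
  prime≥2 {p} pr = nonTrivial⇒n>1 p {{prime⇒nonTrivial pr}}

  square-divisor⇒prime-square-divisor : ∀ {k D} → 2 ≤ k → k * k ∣ D → ∃ λ p → Prime p × p * p ∣ D
  square-divisor⇒prime-square-divisor {k} {D} = <-rec P go k
    where
      P : ℕ → Set
      P k = 2 ≤ k → k * k ∣ D → ∃ λ p → Prime p × p * p ∣ D
      go : ∀ k → (∀ {j} → j < k → P j) → P k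
      go k rec 2≤k k²∣D with prime? k
      ... | yes k-prime = k , k-prime , k²∣D
      ... | no ¬k-prime with ¬prime⇒composite {{n>1⇒nonTrivial 2≤k}} ¬k-prime
      ...   | composite {j} j<k j∣k =
              rec j<k (nonTrivial⇒n>1 j) (∣-trans (*-pres-∣ j∣k j∣k) k²∣D)

  squareFree⊎prime-square-divisor : ∀ D → .{{NonZero D}} → SquareFree D ⊎ ∃ λ p → Prime p × p * p ∣ D
  squareFree⊎prime-square-divisor D with anyUpTo? (λ k → (2 ≤? k) ×-dec (k * k ∣? D)) (suc D)
  ... | yes (k , _ , 2≤k , k²∣D) = inj₂ (square-divisor⇒prime-square-divisor 2≤k k²∣D)
  ... | no ∄k = inj₁ squareFree
    where
      squareFree : SquareFree D
      squareFree 0 0∣D = contradiction (0∣⇒≡0 0∣D) (≢-nonZero⁻¹ D)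
      squareFree 1 _   = refl
      squareFree k@(suc (suc _)) k²∣D =
        contradiction (k , s≤s (≤-trans (m≤m*n k k) (∣⇒≤ k²∣D)) , s≤s (s≤s z≤n) , k²∣D) ∄k

  squareFree? : ∀ D → .{{NonZero D}} → Dec (SquareFree D)
  squareFree? D with squareFree⊎prime-square-divisor D
  ... | inj₁ sf = yes sf
  ... | inj₂ (p , pr , p²∣D) = no λ sf → nonTrivial⇒≢1 {{prime⇒nonTrivial pr}} (sf p p²∣D)

  ∣n²+1⇒∣[n%k]²+1 : ∀ n k .{{_ : NonZero k}} → k ∣ n * n + 1 → k ∣ (n % k) * (n % k) + 1
  ∣n²+1⇒∣[n%k]²+1 n k k∣n²+1 = ∣m+n∣m⇒∣n k∣expanded (m∣m*n _)
    where
      expand : ∀ k r q → (r + q * k) * (r + q * k) + 1 ≡ k * (q * (2 * r + q * k)) + (r * r + 1)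
      expand = solve-∀
      k∣expanded : k ∣ k * (n / k * (2 * (n % k) + n / k * k)) + (n % k * (n % k) + 1)
      k∣expanded = subst (k ∣_) (expand k (n % k) (n / k))
                     (subst (λ w → k ∣ w * w + 1) (m≡m%n+[m/n]*n n k) k∣n²+1)

  ∤n²+1 : ∀ k .{{_ : NonZero k}} → True (allUpTo? (λ r → ¬? (k ∣? r * r + 1)) k) →
          ∀ n → ¬ k ∣ n * n + 1
  ∤n²+1 k residues n k∣n²+1 = toWitness residues (m%n<n n k) (∣n²+1⇒∣[n%k]²+1 n k k∣n²+1)

  prime²∣n²+1⇒5≤p : ∀ {p n} → Prime p → p * p ∣ n * n + 1 → 5 ≤ p
  prime²∣n²+1⇒5≤p {p} {n} pr = go p (prime≥2 pr)
    where
      go : ∀ p → 2 ≤ p → p * p ∣ n * n + 1 → 5 ≤ p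
      go 1 (s≤s ()) _
      go 2 _ 4∣n²+1  = ⊥-elim (∤n²+1 4 _ n 4∣n²+1)
      go 3 _ 9∣n²+1  = ⊥-elim (∤n²+1 3 _ n (m*n∣⇒m∣ 3 3 9∣n²+1))
      go 4 _ 16∣n²+1 = ⊥-elim (∤n²+1 4 _ n (m*n∣⇒m∣ 4 4 16∣n²+1))
      go (suc (suc (suc (suc (suc _))))) _ _ = s≤s (s≤s (s≤s (s≤s (s≤s z≤n))))

  p²∣n²+1⇒p≤n : ∀ {p n} → 1 ≤ n → p * p ∣ n * n + 1 → p ≤ n
  p²∣n²+1⇒p≤n {p} {n@(suc m)} (s≤s z≤n) p²∣n²+1 =
    ≮⇒≥ λ n<p → <⇒≱ (<-≤-trans n²+1<[n+1]² (*-mono-≤ n<p n<p)) (∣⇒≤ p²∣n²+1)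
    where
      expand : ∀ m → (2 + m) * (2 + m) ≡ ((1 + m) * (1 + m) + 1) + suc (2 * m + 1)
      expand = solve-∀
      n²+1<[n+1]² : n * n + 1 < suc n * suc n
      n²+1<[n+1]² = <-witness (2 * m + 1) (expand m)

  roots-of-−1 : ∀ {p} y t → Prime p → p ≢ 2 → p * p ∣ (y + t) * (y + t) + 1 → p * p ∣ y * y + 1 →
                p * p ∣ t ⊎ p * p ∣ (y + t) + y
  roots-of-−1 {p} y t pr p≢2 p²∣x²+1 p²∣y²+1 = dichotomy (p ∣? t)
    where
      expand : ∀ y t → (y + t) * (y + t) + 1 ≡ (y * y + 1) + t * ((y + t) + y)
      expand = solve-∀
      x+y≡t+2y : ∀ y t → (y + t) + y ≡ t + 2 * y
      x+y≡t+2y = solve-∀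
      p²∣t[x+y] : p * p ∣ t * ((y + t) + y)
      p²∣t[x+y] = ∣m+n∣m⇒∣n (subst (p * p ∣_) (expand y t) p²∣x²+1) p²∣y²+1
      p²-coprime : ∀ {m} → ¬ p ∣ m → Coprime (p * p) m
      p²-coprime p∤m = coprime-*ˡ (prime∤⇒coprime pr p∤m) (prime∤⇒coprime pr p∤m)
      ¬p∣2y : ¬ p ∣ 2 * y
      ¬p∣2y p∣2y with euclidsLemma 2 y pr p∣2y
      ... | inj₁ p∣2 = p≢2 (≤-antisym (∣⇒≤ p∣2) (prime≥2 pr))
      ... | inj₂ p∣y = nonTrivial⇒≢1 {{prime⇒nonTrivial pr}}
                         (∣1⇒≡1 (∣m+n∣m⇒∣n (m*n∣⇒m∣ p p p²∣y²+1) (∣m⇒∣m*n y p∣y)))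
      dichotomy : Dec (p ∣ t) → p * p ∣ t ⊎ p * p ∣ (y + t) + y
      dichotomy (yes p∣t) =
        inj₁ (coprime-divisor (p²-coprime p∤x+y) (subst (p * p ∣_) (*-comm t _) p²∣t[x+y]))
        where p∤x+y = λ p∣x+y → ¬p∣2y (∣m+n∣m⇒∣n (subst (p ∣_) (x+y≡t+2y y t) p∣x+y) p∣t)
      dichotomy (no p∤t)  = inj₂ (coprime-divisor (p²-coprime p∤t) p²∣t[x+y])

  2*m≡m+m : ∀ m → 2 * m ≡ m + m
  2*m≡m+m = solve-∀

  /-<-by-multiple : ∀ {m n} q c .{{_ : NonZero q}} → m < c * q → c * q ≤ n → m / q < n / q
  /-<-by-multiple {m} {n} q c m<cq cq≤n =
    <-≤-trans (m<n*o⇒m/o<n m<cq) (subst (_≤ n / q) (m*n/n≡m c q) (/-monoˡ-≤ q cq≤n))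

  -- in both cases of roots-of-−1 a multiple of p² lies in (2y , 2(y + t)]
  [2y]/p²<[2[y+t]]/p² : ∀ {p} y t .{{_ : NonZero (p * p)}} → Prime p → p ≢ 2 →
                       p * p ∣ (y + t) * (y + t) + 1 → p * p ∣ y * y + 1 → 0 < t →
                       (2 * y) / (p * p) < (2 * (y + t)) / (p * p)
  [2y]/p²<[2[y+t]]/p² {p} y t pr p≢2 p²∣x²+1 p²∣y²+1 0<t
    with roots-of-−1 y t pr p≢2 p²∣x²+1 p²∣y²+1
  ... | inj₁ p²∣t = subst ((2 * y) / (p * p) <_) (sym (begin
        (2 * (y + t)) / (p * p)                ≡⟨ /-congˡ (*-distribˡ-+ 2 y t) ⟩
        (2 * y + 2 * t) / (p * p)              ≡⟨ +-distrib-/-∣ʳ (2 * y) (∣n⇒∣m*n 2 p²∣t) ⟩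
        (2 * y) / (p * p) + (2 * t) / (p * p)  ∎))
      (m<m+n _ (m≥n⇒m/n>0 (≤-trans (∣⇒≤ {{>-nonZero 0<t}} p²∣t) (m≤n*m t 2))))
      where open ≡-Reasoning
  ... | inj₂ (divides c x+y≡cp²) = /-<-by-multiple (p * p) c
        (subst (2 * y <_) x+y≡cp² (subst (_< (y + t) + y) (sym (2*m≡m+m y)) (+-monoˡ-< y (m<m+n y 0<t))))
        (subst (_≤ 2 * (y + t)) x+y≡cp²
          (subst ((y + t) + y ≤_) (sym (2*m≡m+m (y + t))) (+-monoʳ-≤ (y + t) (m≤m+n y t))))

  [2x]/p²-strictMono : ∀ {p x y} .{{_ : NonZero (p * p)}} → Prime p → p ≢ 2 →
                       p * p ∣ x * x + 1 → p * p ∣ y * y + 1 → y < x → (2 * y) / (p * p) < (2 * x) / (p * p)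
  [2x]/p²-strictMono {p} {x} {y} pr p≢2 p²∣x²+1 p²∣y²+1 y<x with m≤n⇒∃[o]m+o≡n (<⇒≤ y<x)
  ... | 0     , refl = contradiction (subst (y <_) (+-identityʳ y) y<x) (<-irrefl refl)
  ... | suc o , refl = [2y]/p²<[2[y+t]]/p² y (suc o) pr p≢2 p²∣x²+1 p²∣y²+1 z<s

  [2x]/p²-injective : ∀ {p x y} .{{_ : NonZero (p * p)}} → Prime p → p ≢ 2 →
                      p * p ∣ x * x + 1 → p * p ∣ y * y + 1 →
                      (2 * x) / (p * p) ≡ (2 * y) / (p * p) → x ≡ y
  [2x]/p²-injective {p} {x} {y} pr p≢2 p²∣x²+1 p²∣y²+1 eq with <-cmp x y
  ... | tri< x<y _ _ = contradiction eq (<⇒≢ ([2x]/p²-strictMono pr p≢2 p²∣y²+1 p²∣x²+1 x<y))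
  ... | tri≈ _ x≡y _ = x≡y
  ... | tri> _ _ y<x = contradiction (sym eq) (<⇒≢ ([2x]/p²-strictMono pr p≢2 p²∣x²+1 p²∣y²+1 y<x))

  prime-even⇒≡2 : ∀ {p} → Prime p → 2 ∣ p → p ≡ 2
  prime-even⇒≡2 pr 2∣p with prime⇒irreducible pr 2∣p
  ... | inj₂ 2≡p = sym 2≡p

  2∣m⊎2∣1+m : ∀ m → 2 ∣ m ⊎ 2 ∣ suc m
  2∣m⊎2∣1+m zero = inj₁ (divides 0 refl)
  2∣m⊎2∣1+m (suc m) with 2∣m⊎2∣1+m m
  ... | inj₁ 2∣m   = inj₂ (∣m∣n⇒∣m+n (∣-refl {2}) 2∣m)
  ... | inj₂ 2∣1+m = inj₁ 2∣1+m

  ¬consecutive-primes : ∀ {m} → 3 ≤ m → Prime m → Prime (suc m) → ⊥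
  ¬consecutive-primes {m} 3≤m pr pr′ with 2∣m⊎2∣1+m m
  ... | inj₁ 2∣m   = <⇒≱ 3≤m (≤-reflexive (prime-even⇒≡2 pr 2∣m))
  ... | inj₂ 2∣1+m = <⇒≱ (m≤n⇒m≤1+n 3≤m) (≤-reflexive (prime-even⇒≡2 pr′ 2∣1+m))

  prime≥5⇒residue : ∀ {p} → Prime p → 5 ≤ p → p ≡ 1 + p / 3 * 3 ⊎ p ≡ 2 + p / 3 * 3
  prime≥5⇒residue {p} pr 5≤p = residue (p % 3) (m%n<n p 3) (m≡m%n+[m/n]*n p 3)
    where
      residue : ∀ r → r < 3 → p ≡ r + p / 3 * 3 → p ≡ 1 + p / 3 * 3 ⊎ p ≡ 2 + p / 3 * 3
      residue 0 _ p≡3c with prime⇒irreducible pr (divides (p / 3) p≡3c)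
      ... | inj₂ 3≡p = ⊥-elim (<⇒≱ (≤-trans (n≤1+n 4) 5≤p) (≤-reflexive (sym 3≡p)))
      residue 1 _ p≡ = inj₁ p≡
      residue 2 _ p≡ = inj₂ p≡
      residue (suc (suc (suc _))) (s≤s (s≤s (s≤s ()))) _

  prime≥5-/3-injective : ∀ {p p′} → Prime p → Prime p′ → 5 ≤ p → 5 ≤ p′ →
                         p / 3 ≡ p′ / 3 → p ≡ p′
  prime≥5-/3-injective {p} {p′} pr pr′ 5≤p 5≤p′ eq
    with prime≥5⇒residue pr 5≤p | prime≥5⇒residue pr′ 5≤p′
  ... | inj₁ p≡ | inj₁ p′≡ = trans p≡ (trans (cong (λ c → 1 + c * 3) eq) (sym p′≡))
  ... | inj₂ p≡ | inj₂ p′≡ = trans p≡ (trans (cong (λ c → 2 + c * 3) eq) (sym p′≡))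
  ... | inj₁ p≡ | inj₂ p′≡ = ⊥-elim (¬consecutive-primes 3≤p pr (subst Prime (sym (begin
          suc p                 ≡⟨ cong suc p≡ ⟩
          2 + p / 3 * 3         ≡⟨ cong (λ c → 2 + c * 3) eq ⟩
          2 + p′ / 3 * 3        ≡⟨ p′≡ ⟨
          p′                    ∎)) pr′))
    where
      open ≡-Reasoning
      3≤p = ≤-trans (s≤s (s≤s (s≤s z≤n))) 5≤p
  ... | inj₂ p≡ | inj₁ p′≡ = ⊥-elim (¬consecutive-primes 3≤p′ pr′ (subst Prime (sym (begin
          suc p′                ≡⟨ cong suc p′≡ ⟩
          2 + p′ / 3 * 3        ≡⟨ cong (λ c → 2 + c * 3) eq ⟨
          2 + p / 3 * 3         ≡⟨ p≡ ⟨
          p                     ∎)) pr))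
    where
      open ≡-Reasoning
      3≤p′ = ≤-trans (s≤s (s≤s (s≤s z≤n))) 5≤p′

  m*n≤o⇒m≤o/n : ∀ m n {o} .{{_ : NonZero n}} → m * n ≤ o → m ≤ o / n
  m*n≤o⇒m≤o/n m n {o} mn≤o = subst (_≤ o / n) (m*n/n≡m m n) (/-monoˡ-≤ n mn≤o)

  M/[c+1]²+M/[c+1]≤M/c : ∀ M c .{{_ : NonZero c}} → M / (suc c * suc c) + M / suc c ≤ M / c
  M/[c+1]²+M/[c+1]≤M/c M c = m*n≤o⇒m≤o/n (a + b) c (begin
      (a + b) * c          ≡⟨ *-distribʳ-+ c a b ⟩
      a * c + b * c        ≤⟨ +-monoˡ-≤ (b * c) (≤-trans (m≤n+m (a * c) a) (≤-reflexive (sym (*-suc a c)))) ⟩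
      a * suc c + b * c    ≤⟨ +-monoˡ-≤ (b * c) a[c+1]≤b ⟩
      b + b * c            ≡⟨ *-suc b c ⟨
      b * suc c            ≤⟨ m/n*n≤m M (suc c) ⟩
      M                    ∎)
    where
      open ≤-Reasoning
      a = M / (suc c * suc c)
      b = M / suc c
      a[c+1]≤b : a * suc c ≤ b
      a[c+1]≤b = m*n≤o⇒m≤o/n (a * suc c) (suc c)
                   (≤-trans (≤-reflexive (*-assoc a (suc c) (suc c))) (m/n*n≤m M (suc c * suc c)))

  injection⇒≤ : ∀ {N R} (f : ∀ i → i < N → ℕ) → (∀ i i<N → f i i<N < R) →
                (∀ i j i<N j<N → f i i<N ≡ f j j<N → i ≡ j) → N ≤ R
  injection⇒≤ {N} {R} f f<R f-injective = ≮⇒≥ λ R<N → collision (Fin.pigeonhole R<N g)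
    where
      g : Fin N → Fin R
      g i = fromℕ< (f<R (toℕ i) (Fin.toℕ<n i))
      collision : ∃ (λ i → ∃ λ j → i <ᶠ j × g i ≡ g j) → ⊥
      collision (i , j , i<j , gi≡gj) = <-irrefl (f-injective _ _ _ _ (begin
        f (toℕ i) _         ≡⟨ Fin.toℕ-fromℕ< (f<R (toℕ i) (Fin.toℕ<n i)) ⟨
        toℕ (g i)           ≡⟨ cong toℕ gi≡gj ⟩
        toℕ (g j)           ≡⟨ Fin.toℕ-fromℕ< (f<R (toℕ j) (Fin.toℕ<n j)) ⟩
        f (toℕ j) _         ∎)) i<j
        where open ≡-Reasoning

  module Encoding (M K : ℕ) where

    width : ℕ → ℕ
    width s = suc ((2 * M) / ((5 + s) * (5 + s)))

    -- the codes of the prime 5 + s ≤ K fill [offset s , offset (suc s))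
    offset : ℕ → ℕ
    offset zero    = 0
    offset (suc s) = offset s + width s

    offset-mono : ∀ {s s′} → s ≤ s′ → offset s ≤ offset s′
    offset-mono {s} {s′} s≤s′ with m≤n⇒∃[o]m+o≡n s≤s′
    ... | o , refl = grow s o
      where
        grow : ∀ s o → offset s ≤ offset (s + o)
        grow s zero    = ≤-reflexive (cong offset (sym (+-identityʳ s)))
        grow s (suc o) = ≤-trans (grow s o)
          (≤-trans (m≤m+n (offset (s + o)) _) (≤-reflexive (cong offset (sym (+-suc s o)))))

    offset-bound : ∀ s → offset s + (2 * M) / (4 + s) ≤ (2 * M) / 4 + s
    offset-bound zero    = ≤-reflexive (sym (+-identityʳ ((2 * M) / 4)))
    offset-bound (suc s) = begin
      (offset s + suc (L / ((5 + s) * (5 + s)))) + L / (5 + s)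
        ≡⟨ regroup (offset s) (L / ((5 + s) * (5 + s))) (L / (5 + s)) ⟩
      suc (offset s + (L / ((5 + s) * (5 + s)) + L / (5 + s)))
        ≤⟨ s≤s (+-monoʳ-≤ (offset s) (M/[c+1]²+M/[c+1]≤M/c L (4 + s))) ⟩
      suc (offset s + L / (4 + s))
        ≤⟨ s≤s (offset-bound s) ⟩
      suc (L / 4 + s)
        ≡⟨ +-suc (L / 4) s ⟨
      L / 4 + suc s
        ∎
      where
        open ≤-Reasoning
        L = 2 * M
        regroup : ∀ o a b → (o + suc a) + b ≡ suc (o + (a + b))
        regroup = solve-∀

    large-offset : ℕ
    large-offset = offset (K ∸ 4)

    code-bound : ℕ
    code-bound = large-offset + M / 3 + 1

    code : ℕ → ℕ → ℕ
    code n s with 5 + s ≤? K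
    ... | yes _ = offset s + (2 * n) / ((5 + s) * (5 + s))
    ... | no  _ = large-offset + (5 + s) / 3

    small-code<offset : ∀ {n s s′} → n ≤ M → s < s′ → offset s + (2 * n) / ((5 + s) * (5 + s)) < offset s′
    small-code<offset {n} {s} n≤M s<s′ =
      <-≤-trans (+-monoʳ-< (offset s) (s≤s (/-monoˡ-≤ ((5 + s) * (5 + s)) (*-monoʳ-≤ 2 n≤M)))) (offset-mono s<s′)

    small-code<large-offset : ∀ {n} s → n ≤ M → 5 + s ≤ K →
                              offset s + (2 * n) / ((5 + s) * (5 + s)) < large-offset
    small-code<large-offset s n≤M 5+s≤K = small-code<offset n≤M (∸-monoˡ-≤ 4 5+s≤K)

    code<code-bound : ∀ {n} s → 1 ≤ n → n ≤ M → (5 + s) * (5 + s) ∣ n * n + 1 → code n s < code-bound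
    code<code-bound {n} s 1≤n n≤M p²∣n²+1 with 5 + s ≤? K
    ... | yes 5+s≤K = <-≤-trans (small-code<large-offset s n≤M 5+s≤K)
                                (≤-trans (m≤m+n large-offset (M / 3)) (m≤m+n (large-offset + M / 3) 1))
    ... | no  _     = ≤-<-trans (+-monoʳ-≤ large-offset p/3≤M/3) (m<m+n (large-offset + M / 3) z<s)
      where p/3≤M/3 = /-monoˡ-≤ {m = 5 + s} 3 (≤-trans (p²∣n²+1⇒p≤n 1≤n p²∣n²+1) n≤M)

    code-bound<M∸m : ∀ m → 6 * (K + m + 1) < M → code-bound < M ∸ m
    code-bound<M∸m m 6[K+m+1]<M =
      m+n≤o⇒m≤o∸n (suc code-bound) (*-cancelˡ-< 12 (code-bound + m) M (begin-strict
      12 * (large-offset + M / 3 + 1 + m)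
        ≤⟨ *-monoʳ-≤ 12 (+-monoˡ-≤ m (+-monoˡ-≤ 1 (+-monoˡ-≤ (M / 3) large-offset≤))) ⟩
      12 * ((2 * M) / 4 + K + M / 3 + 1 + m)
        ≡⟨ regroup ((2 * M) / 4) (M / 3) K m ⟩
      3 * ((2 * M) / 4 * 4) + 4 * (M / 3 * 3) + 2 * (6 * (K + m + 1))
        <⟨ +-monoʳ-< (3 * ((2 * M) / 4 * 4) + 4 * (M / 3 * 3)) (*-monoʳ-< 2 6[K+m+1]<M) ⟩
      3 * ((2 * M) / 4 * 4) + 4 * (M / 3 * 3) + 2 * M
        ≤⟨ +-monoˡ-≤ (2 * M) (+-mono-≤ (*-monoʳ-≤ 3 (m/n*n≤m (2 * M) 4)) (*-monoʳ-≤ 4 (m/n*n≤m M 3))) ⟩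
      3 * (2 * M) + 4 * M + 2 * M
        ≡⟨ total M ⟩
      12 * M ∎))
      where
        open ≤-Reasoning
        large-offset≤ : large-offset ≤ (2 * M) / 4 + K
        large-offset≤ = ≤-trans (m≤m+n large-offset _)
                          (≤-trans (offset-bound (K ∸ 4)) (+-monoʳ-≤ ((2 * M) / 4) (m∸n≤m K 4)))
        regroup : ∀ A B K m → 12 * (A + K + B + 1 + m) ≡ 3 * (A * 4) + 4 * (B * 3) + 2 * (6 * (K + m + 1))
        regroup = solve-∀
        total : ∀ M → 3 * (2 * M) + 4 * M + 2 * M ≡ 12 * M
        total = solve-∀

    small-code-injective : ∀ {n n′ s s′} → n ≤ M → n′ ≤ M → Prime (5 + s) →
                           (5 + s) * (5 + s) ∣ n * n + 1 → (5 + s′) * (5 + s′) ∣ n′ * n′ + 1 →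
                           offset s + (2 * n) / ((5 + s) * (5 + s)) ≡ offset s′ + (2 * n′) / ((5 + s′) * (5 + s′)) →
                           n ≡ n′
    small-code-injective {s = s} {s′} n≤M n′≤M pr p²∣n²+1 p′²∣n′²+1 eq with <-cmp s s′
    ... | tri< s<s′ _ _ =
      ⊥-elim (<⇒≱ (<-≤-trans (small-code<offset n≤M s<s′) (m≤m+n _ _)) (≤-reflexive (sym eq)))
    ... | tri≈ _ refl _ = [2x]/p²-injective pr (λ ()) p²∣n²+1 p′²∣n′²+1 (+-cancelˡ-≡ (offset s) _ _ eq)
    ... | tri> _ _ s′<s =
      ⊥-elim (<⇒≱ (<-≤-trans (small-code<offset n′≤M s′<s) (m≤m+n _ _)) (≤-reflexive eq))

    module _ (2M<[K+1]² : 2 * M < suc K * suc K) where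

      large-prime⇒[2n]/p²≡0 : ∀ {n} s → n ≤ M → ¬ 5 + s ≤ K → (2 * n) / ((5 + s) * (5 + s)) ≡ 0
      large-prime⇒[2n]/p²≡0 s n≤M 5+s≰K =
        m<n⇒m/n≡0 (≤-<-trans (*-monoʳ-≤ 2 n≤M) (<-≤-trans 2M<[K+1]² (*-mono-≤ K<p K<p)))
        where K<p = ≰⇒> 5+s≰K

      code-injective : ∀ {n n′ s s′} → n ≤ M → n′ ≤ M → Prime (5 + s) → Prime (5 + s′) →
                       (5 + s) * (5 + s) ∣ n * n + 1 → (5 + s′) * (5 + s′) ∣ n′ * n′ + 1 →
                       code n s ≡ code n′ s′ → n ≡ n′
      code-injective {s = s} {s′} n≤M n′≤M pr pr′ p²∣n²+1 p′²∣n′²+1 eq with 5 + s ≤? K | 5 + s′ ≤? K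
      ... | yes _     | yes _      = small-code-injective n≤M n′≤M pr p²∣n²+1 p′²∣n′²+1 eq
      ... | yes small | no _       =
        ⊥-elim (<⇒≱ (small-code<large-offset s n≤M small) (≤-trans (m≤m+n large-offset _) (≤-reflexive (sym eq))))
      ... | no _      | yes small′ =
        ⊥-elim (<⇒≱ (small-code<large-offset s′ n′≤M small′) (≤-trans (m≤m+n large-offset _) (≤-reflexive eq)))
      ... | no large  | no _
        with prime≥5-/3-injective pr pr′ (m≤m+n 5 s) (m≤m+n 5 s′) (+-cancelˡ-≡ large-offset _ _ eq)
      ...   | refl = [2x]/p²-injective pr (λ ()) p²∣n²+1 p′²∣n′²+1
                       (trans (large-prime⇒[2n]/p²≡0 s n≤M large) (sym (large-prime⇒[2n]/p²≡0 s n′≤M large)))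

  n²+1-nonZero : ∀ n → NonZero (n * n + 1)
  n²+1-nonZero n = >-nonZero (subst (0 <_) (+-comm 1 (n * n)) z<s)

  non-squareFree⇒prime≥5-square-divisor : ∀ n → ¬ SquareFree (n * n + 1) →
                                          ∃ λ s → Prime (5 + s) × (5 + s) * (5 + s) ∣ n * n + 1
  non-squareFree⇒prime≥5-square-divisor n ¬sf
    with squareFree⊎prime-square-divisor (n * n + 1) {{n²+1-nonZero n}}
  ... | inj₁ sf = contradiction sf ¬sf
  ... | inj₂ (p , pr , p²∣n²+1) with m≤n⇒∃[o]m+o≡n (prime²∣n²+1⇒5≤p {n = n} pr p²∣n²+1)
  ...   | s , refl = s , pr , p²∣n²+1

  squareFree-n²+1-above : ∀ m M K → 2 * M < suc K * suc K → 6 * (K + m + 1) < M →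
                          ∃ λ n → m < n × SquareFree (n * n + 1)
  squareFree-n²+1-above m M K 2M<[K+1]² 6[K+m+1]<M =
    search (anyUpTo? (λ i → squareFree? (nth i * nth i + 1) {{n²+1-nonZero (nth i)}}) (M ∸ m))
    where
      open Encoding M K
      nth : ℕ → ℕ
      nth i = suc m + i
      m≤M : m ≤ M
      m≤M = ≤-trans (m≤n+m m K)
              (≤-trans (m≤m+n (K + m) 1) (≤-trans (m≤n*m (K + m + 1) 6) (<⇒≤ 6[K+m+1]<M)))
      nth≤M : ∀ {i} → i < M ∸ m → nth i ≤ M
      nth≤M {i} i<M∸m = subst (_≤ M) (cong suc (+-comm i m)) (m≤o∸n⇒m+n≤o (suc i) m≤M i<M∸m)
      search : Dec (∃ λ i → i < M ∸ m × SquareFree (nth i * nth i + 1)) →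
               ∃ λ n → m < n × SquareFree (n * n + 1)
      search (yes (i , _ , sf)) = nth i , s≤s (m≤m+n m i) , sf
      search (no none) = ⊥-elim (<⇒≱ (code-bound<M∸m m 6[K+m+1]<M) (injection⇒≤ f f<code-bound f-injective))
        where
          obstruction : ∀ i → i < M ∸ m → ∃ λ s → Prime (5 + s) × (5 + s) * (5 + s) ∣ nth i * nth i + 1
          obstruction i i<M∸m = non-squareFree⇒prime≥5-square-divisor (nth i) (λ sf → none (i , i<M∸m , sf))
          f : ∀ i → i < M ∸ m → ℕ
          f i i<M∸m = code (nth i) (proj₁ (obstruction i i<M∸m))
          f<code-bound : ∀ i i<M∸m → f i i<M∸m < code-bound
          f<code-bound i i<M∸m with obstruction i i<M∸m
          ... | s , _ , p²∣ = code<code-bound s (s≤s z≤n) (nth≤M i<M∸m) p²∣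
          f-injective : ∀ i j i<M∸m j<M∸m → f i i<M∸m ≡ f j j<M∸m → i ≡ j
          f-injective i j i<M∸m j<M∸m eq with obstruction i i<M∸m | obstruction j j<M∸m
          ... | s , pr , p²∣ | s′ , pr′ , p′²∣ =
            +-cancelˡ-≡ (suc m) i j
              (code-injective 2M<[K+1]² (nth≤M i<M∸m) (nth≤M j<M∸m) pr pr′ p²∣ p′²∣ eq)

  infinitely-many-squareFree-n²+1 : ∀ m → ∃ λ n → m < n × SquareFree (n * n + 1)
  infinitely-many-squareFree-n²+1 m = squareFree-n²+1-above m (2 * (j * j)) (2 * j) 2M<[K+1]² 6[K+m+1]<M
    where
      j = m + 7
      [2j+1]²≡ : ∀ j → suc (2 * j) * suc (2 * j) ≡ 2 * (2 * (j * j)) + suc (4 * j)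
      [2j+1]²≡ = solve-∀
      2M<[K+1]² : 2 * (2 * (j * j)) < suc (2 * j) * suc (2 * j)
      2M<[K+1]² = <-witness (4 * j) ([2j+1]²≡ j)
      2j²≡ : ∀ m → 2 * ((m + 7) * (m + 7)) ≡ 6 * (2 * (m + 7) + m + 1) + suc (2 * m * m + 10 * m + 7)
      2j²≡ = solve-∀
      6[K+m+1]<M : 6 * (2 * j + m + 1) < 2 * (j * j)
      6[K+m+1]<M = <-witness (2 * m * m + 10 * m + 7) (2j²≡ m)

open import Defs
open import Data.Nat using (ℕ; _<_; _+_; _*_)
open import Data.Integer using (+_)
open import Data.Rational using (_/_; 1ℚ)
open import Data.Product using (_×_; _,_; ∃-syntax)
open import Data.Nat.Properties using (≤-trans; m≤m+n; m≤n+m)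
open import Data.Nat.Base using (s≤s)

lemma3p18 : ∀ (m : ℕ) → ∃[ n ] (m < n × SquareFree (n * n + 1)
              × Field.IsFundamentalUnit (n * n + 1) ((+ n / 1) , 1ℚ))
lemma3p18 m =
  let n , m+2<n , sf = SquareFreeValues.infinitely-many-squareFree-n²+1 (m + 2)
  in n , ≤-trans (s≤s (m≤m+n m 2)) m+2<n , sf ,
     FundamentalUnit.ε-fundamental n (≤-trans (s≤s (m≤n+m 2 m)) m+2<n) sf
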